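{- Let $\ell \geq 3$ be an integer, let $G$ be a graph, and let $C$ be an induced cycle in $G$. If some component of $G - V(C)$ has at least $\ell$ neighbours in $C$, then $G$ contains $W_\ell$ as an induced minor.
   Context: All graphs are finite and simple. $W_\ell$ is the graph obtained from a cycle of length $\ell$ by adding a vertex adjacent to all vertices of the cycle. A graph $H$ is an induced minor of $G$ if $H$ is isomorphic to a graph obtained from $G$ by deleting vertices and contracting edges (removing parallel edges). -}

module Defs where

open import Data.Nat using (ℕ; zero; suc; _≤_; _≡ᵇ_)
open import Data.Fin using (Fin; zero; suc; toℕ; punchIn; _≟_)
open import Data.Bool using (Bool; true; false; _∧_; _∨_; not; T)
open import Data.Product using (Σ; ∃; _×_; _,_)
open import Relation.Nullary using (¬_)
open import Relation.Nullary.Decidable using (⌊_⌋)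
open import Relation.Binary.PropositionalEquality using (_≡_; _≢_)
open import Function.Definitions using (Injective)

Graph : ℕ → Set
Graph n = Fin n → Fin n → Bool

Adj : ∀ {n} → Graph n → Fin n → Fin n → Set
Adj G u v = T (G u v)

IsSimple : ∀ {n} → Graph n → Set
IsSimple G = (∀ u v → G u v ≡ G v u) × (∀ v → G v v ≡ false)

_==ᶠ_ : ∀ {n} → Fin n → Fin n → Bool
x ==ᶠ y = ⌊ x ≟ y ⌋

delete : ∀ {n} → Graph (suc n) → Fin (suc n) → Graph n
delete G i x y = G (punchIn i x) (punchIn i y)

-- contracting the edge ij: vertex j is removed and merged into i;
-- parallel edges and loops are discarded.
contract : ∀ {n} → Graph (suc n) → Fin (suc n) → Fin (suc n) → Graph n
contract G i j x y =
  not (x ==ᶠ y) ∧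
    (G (punchIn j x) (punchIn j y)
     ∨ ((punchIn j x ==ᶠ i) ∧ G j (punchIn j y))
     ∨ ((punchIn j y ==ᶠ i) ∧ G j (punchIn j x)))

record _≅_ {m n} (H : Graph m) (G : Graph n) : Set where
  field
    to      : Fin m → Fin n
    from    : Fin n → Fin m
    from∘to : ∀ x → from (to x) ≡ x
    to∘from : ∀ y → to (from y) ≡ y
    pres    : ∀ x y → H x y ≡ G (to x) (to y)

data _≼_ {m} (H : Graph m) : ∀ {n} → Graph n → Set where
  iso : ∀ {n} {G : Graph n} → H ≅ G → H ≼ G
  del : ∀ {n} {G : Graph (suc n)} (i : Fin (suc n)) → H ≼ delete G i → H ≼ G
  con : ∀ {n} {G : Graph (suc n)} (i j : Fin (suc n)) → i ≢ j → Adj G i j →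
        H ≼ contract G i j → H ≼ G

cycSucc : (ℓ : ℕ) → Fin ℓ → Fin ℓ → Bool
cycSucc ℓ i j = (toℕ j ≡ᵇ suc (toℕ i)) ∨ ((suc (toℕ i) ≡ᵇ ℓ) ∧ (toℕ j ≡ᵇ 0))

cycAdj : (ℓ : ℕ) → Fin ℓ → Fin ℓ → Bool
cycAdj ℓ i j = cycSucc ℓ i j ∨ cycSucc ℓ j i

wheel : (ℓ : ℕ) → Graph (suc ℓ)
wheel ℓ zero    zero    = false
wheel ℓ zero    (suc _) = true
wheel ℓ (suc _) zero    = true
wheel ℓ (suc i) (suc j) = cycAdj ℓ i j

record InducedCycle {n} (G : Graph n) : Set where
  field
    len     : ℕ
    len≥3   : 3 ≤ len
    vtx     : Fin len → Fin n
    inj     : Injective _≡_ _≡_ vtx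
    induced : ∀ i j → G (vtx i) (vtx j) ≡ cycAdj len i j
open InducedCycle public

InC : ∀ {n} {G : Graph n} → InducedCycle G → Fin n → Set
InC C v = ∃ λ i → vtx C i ≡ v

data Walk {n} (G : Graph n) (P : Fin n → Set) : Fin n → Fin n → Set where
  here : ∀ {v} → P v → Walk G P v v
  step : ∀ {u v w} → P u → Adj G u v → Walk G P v w → Walk G P u w

record IsComponent {n} (G : Graph n) (C : InducedCycle G) (S : Fin n → Bool) : Set where
  field
    nonempty : ∃ λ v → T (S v)
    avoids   : ∀ v → T (S v) → ¬ InC C v
    conn     : ∀ u v → T (S u) → T (S v) → Walk G (λ w → T (S w)) u v
    closed   : ∀ u v → T (S u) → Adj G u v → ¬ InC C v → T (S v)

NbrInC : ∀ {n} {G : Graph n} (C : InducedCycle G) → (Fin n → Bool) → Fin (len C) → Set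
NbrInC {G = G} C S i = ∃ λ s → T (S s) × Adj G s (vtx C i)

{-# OPTIONS --safe #-}
-- Cut C, in the order of its positions, into ℓ arcs of consecutive vertices, each containing exactly
-- one of the ℓ given neighbours of S. Contracting S to the hub and every arc to a rim vertex, and
-- deleting all other vertices, gives W_ℓ: the hub sees every arc because each arc contains a
-- neighbour of S, consecutive arcs are joined by an edge of C, and non-consecutive arcs are not
-- adjacent because C is induced. Such a choice of branch sets is an induced-minor model, and by
-- induction on the number of vertices every model is realised by deleting the unused vertices and
-- contracting edges inside branch sets.
module Submission where

open import Defs
open import Data.Nat as ℕ
  using (ℕ; zero; suc; pred; _+_; _∸_; _≤_; _<_; z≤n; s≤s; _<?_; _≡ᵇ_; >-nonZero)
open import Data.Nat.Properties
  using ( ≤-refl; ≤-reflexive; ≤-trans; ≤-antisym; ≤-total; ≤-pred; ≤-<-trans; <-≤-trans; <-irrefl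
        ; <⇒≤; <⇒≢; ≮⇒≥; n≤1+n; n<1+n; 1+n≢n; m<n⇒m<1+n; m≤n⇒m<n∨m≡n; m<1+n⇒m<n∨m≡n
        ; pred-mono-≤; pred[n]≤n; <⇒≤pred; m≤pred[n]⇒suc[m]≤n; suc-pred
        ; +-comm; +-suc; +-identityʳ; m≤m+n; m+[n∸m]≡n; ≡ᵇ⇒≡; ≡⇒≡ᵇ; +-0-commutativeMonoid )
open import Data.Fin using (Fin; zero; suc; toℕ; fromℕ<; punchIn; punchOut; _≟_)
open import Data.Fin.Properties
  using ( any?; suc-injective; 0≢1+n; toℕ-injective; toℕ<n; toℕ-fromℕ<
        ; punchIn-injective; punchInᵢ≢i; punchIn-punchOut; punchOut-punchIn )
open import Data.Bool using (Bool; true; false; _∧_; _∨_; not; T)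
open import Data.Bool.Properties using (∨-comm; T-∧; T-∨)
open import Data.Maybe using (Maybe; just; nothing)
open import Data.Maybe.Properties using (just-injective) renaming (≡-dec to ≡-decᴹ)
open import Data.Product as Product using (∃; ∃₂; _×_; _,_; proj₁; proj₂)
open import Data.Sum as Sum using (_⊎_; inj₁; inj₂)
open import Data.Empty using (⊥-elim)
open import Function using (_∘_; id; _⇔_; mk⇔; Equivalence)
open import Function.Definitions using (Injective)
open import Relation.Nullary using (¬_; Dec; yes; no; contradiction)
open import Relation.Nullary.Decidable
  using (toSum; toWitness; toWitnessFalse; fromWitness; fromWitnessFalse; map′; _×-dec_; T?)
open import Relation.Unary using (Pred; Decidable)
open import Relation.Binary.PropositionalEquality
  using (_≡_; _≢_; refl; sym; trans; cong; cong₂; subst; subst₂; module ≡-Reasoning)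
open import Algebra.Properties.CommutativeMonoid.Sum +-0-commutativeMonoid
  using (sum; ∑-distrib-+; sum-cong-≗)

open Equivalence using (to; from)

IsSymmetric : ∀ {n} → Graph n → Set
IsSymmetric G = ∀ u v → G u v ≡ G v u

IsLoopless : ∀ {n} → Graph n → Set
IsLoopless G = ∀ v → G v v ≡ false

T-ext : ∀ {a b} → (T a → T b) → (T b → T a) → a ≡ b
T-ext {false} {false} _ _ = refl
T-ext {false} {true}  _ g = ⊥-elim (g _)
T-ext {true}  {false} f _ = ⊥-elim (f _)
T-ext {true}  {true}  _ _ = refl

just-or-nothing : ∀ {A : Set} (a : Maybe A) → a ≢ nothing → ∃ λ x → a ≡ just x
just-or-nothing (just x) _ = x , refl
just-or-nothing nothing  a≢nothing = contradiction refl a≢nothing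

sameJust? : ∀ {m} (a b : Maybe (Fin m)) → Dec (∃ λ h → a ≡ just h × b ≡ just h)
sameJust? nothing  _         = no λ { (_ , () , _) }
sameJust? (just h) nothing   = no λ { (_ , _ , ()) }
sameJust? (just h) (just h′) =
  map′ (λ { refl → h , refl , refl }) (λ { (_ , refl , refl) → refl }) (h ≟ h′)

module _ {n} {G : Graph n} where

  adj-sym : IsSymmetric G → ∀ {u v} → Adj G u v → Adj G v u
  adj-sym G-sym {u} {v} = subst T (G-sym u v)

  adj⇒≢ : IsLoopless G → ∀ {u v} → Adj G u v → u ≢ v
  adj⇒≢ G-loopless {u} uv refl = subst T (G-loopless u) uv

  walk-head : ∀ {P u v} → Walk G P u v → P u
  walk-head (here p)     = p
  walk-head (step p _ _) = p

  walk-weaken : ∀ {P Q : Fin n → Set} → (∀ {w} → P w → Q w) → ∀ {u v} → Walk G P u v → Walk G Q u v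
  walk-weaken P⇒Q (here p)        = here (P⇒Q p)
  walk-weaken P⇒Q (step p uv vw)  = step (P⇒Q p) uv (walk-weaken P⇒Q vw)

  _++ʷ_ : ∀ {P u v w} → Walk G P u v → Walk G P v w → Walk G P u w
  here _       ++ʷ q = q
  step p uv vw ++ʷ q = step p uv (vw ++ʷ q)

  walk-reverse : IsSymmetric G → ∀ {P u v} → Walk G P u v → Walk G P v u
  walk-reverse G-sym (here p)       = here p
  walk-reverse G-sym (step p uv vw) =
    walk-reverse G-sym vw ++ʷ step (walk-head vw) (adj-sym G-sym uv) (here p)

walk-map : ∀ {a b} {G : Graph a} {G′ : Graph b} {P : Fin a → Set} {Q : Fin b → Set}
  (R : Fin a → Fin b → Set) →
  (∀ {w z z′} → R w z → R w z′ → z ≡ z′) →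
  (∀ {w} → P w → ∃ λ z → R w z × Q z) →
  (∀ {w w′ z z′} → R w z → R w′ z′ → Adj G w w′ → z ≡ z′ ⊎ Adj G′ z z′) →
  ∀ {u v x y} → Walk G P u v → R u x → R v y → Walk G′ Q x y
walk-map R functional defined edge (here p) ux vy with defined p
... | z , uz , qz rewrite functional uz ux | functional ux vy = here qz
walk-map R functional defined edge (step p uv vw) ux wy with defined p | defined (walk-head vw)
... | z , uz , qz | z′ , vz′ , _ rewrite functional uz ux with edge ux vz′ uv
... | inj₁ refl = walk-map R functional defined edge vw vz′ wy
... | inj₂ xz′  = step qz xz′ (walk-map R functional defined edge vw vz′ wy)

-- Induced-minor models

-- The branch set of h is the fibre of branch over just h; vertices sent to nothing get deleted.
-- adj-project and adj-lift make the model induced: two branch sets touch iff their vertices are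
-- adjacent in H.
record MinorModel {m n} (H : Graph m) (G : Graph n) : Set where
  field
    branch      : Fin n → Maybe (Fin m)
    nonempty    : ∀ h → ∃ λ v → branch v ≡ just h
    connected   : ∀ h {u v} → branch u ≡ just h → branch v ≡ just h →
                  Walk G (λ w → branch w ≡ just h) u v
    adj-project : ∀ {h h′ u v} → h ≢ h′ → branch u ≡ just h → branch v ≡ just h′ →
                  Adj G u v → Adj H h h′
    adj-lift    : ∀ {h h′} → h ≢ h′ → Adj H h h′ →
                  ∃₂ λ u v → branch u ≡ just h × branch v ≡ just h′ × Adj G u v

module _ {m n} {H : Graph m} {G : Graph (suc n)} (M : MinorModel H G) where
  open MinorModel M

  delete-model : ∀ d → branch d ≡ nothing → MinorModel H (delete G d)
  delete-model d d-unused = record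
    { branch      = branch ∘ punchIn d
    ; nonempty    = λ h → let z , _ , ez = survivor (proj₂ (nonempty h)) in z , ez
    ; connected   = λ h ex ey →
        walk-map (λ w z → punchIn d z ≡ w) (λ dz dz′ → punchIn-injective d _ _ (trans dz (sym dz′)))
          survivor (λ { refl refl a → inj₂ a }) (connected h ex ey) refl refl
    ; adj-project = adj-project
    ; adj-lift    = λ hh′ a →
        let u , v , eu , ev , uv = adj-lift hh′ a
            x , ux , ex = survivor eu
            y , vy , ey = survivor ev
        in x , y , ex , ey , subst₂ (Adj G) (sym ux) (sym vy) uv
    }
    where
    survivor : ∀ {w h} → branch w ≡ just h → ∃ λ z → punchIn d z ≡ w × branch (punchIn d z) ≡ just h
    survivor {w} ew = punchOut d≢w , punchIn-punchOut d≢w , trans (cong branch (punchIn-punchOut d≢w)) ew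
      where
      d≢w : d ≢ w
      d≢w refl with trans (sym d-unused) ew
      ... | ()

module Contraction {n} (G : Graph (suc n)) (i j : Fin (suc n)) (i≢j : i ≢ j) where

  -- The vertex of contract G i j that w becomes: vertex x of contract G i j is punchIn j x of G,
  -- and j is merged into i.
  merge : Fin (suc n) → Fin n
  merge w with w ≟ j
  ... | yes _  = punchOut (i≢j ∘ sym)
  ... | no w≢j = punchOut (w≢j ∘ sym)

  merge-punchIn : ∀ x → merge (punchIn j x) ≡ x
  merge-punchIn x with punchIn j x ≟ j
  ... | yes jx≡j = contradiction jx≡j (punchInᵢ≢i j x)
  ... | no _     = punchOut-punchIn j

  punchIn-merge : ∀ w → (w ≡ j × punchIn j (merge w) ≡ i) ⊎ punchIn j (merge w) ≡ w
  punchIn-merge w with w ≟ j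
  ... | yes w≡j = inj₁ (w≡j , punchIn-punchOut _)
  ... | no _    = inj₂ (punchIn-punchOut _)

  merge-j : ∀ {x} → punchIn j x ≡ i → merge j ≡ x
  merge-j {x} jx≡i with punchIn-merge j
  ... | inj₁ (_ , jm≡i) = punchIn-injective j _ _ (trans jm≡i (sym jx≡i))
  ... | inj₂ jm≡j       = contradiction jm≡j (punchInᵢ≢i j _)

  ContractAdj : Fin n → Fin n → Set
  ContractAdj x y = Adj G (punchIn j x) (punchIn j y)
                  ⊎ (punchIn j x ≡ i × Adj G j (punchIn j y))
                  ⊎ (punchIn j y ≡ i × Adj G j (punchIn j x))

  private
    via : Fin n → Fin n → Bool
    via x y = (punchIn j x ==ᶠ i) ∧ G j (punchIn j y)

    via⁺ : ∀ {x y} → punchIn j x ≡ i × Adj G j (punchIn j y) → T (via x y)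
    via⁺ {x} (e , a) = from (T-∧ {x = punchIn j x ==ᶠ i}) (fromWitness e , a)

    via⁻ : ∀ {x y} → T (via x y) → punchIn j x ≡ i × Adj G j (punchIn j y)
    via⁻ {x} t = let e , a = to (T-∧ {x = punchIn j x ==ᶠ i}) t in toWitness e , a

  contract-adj⁺ : ∀ {x y} → x ≢ y → ContractAdj x y → Adj (contract G i j) x y
  contract-adj⁺ {x} {y} x≢y xy =
    from T-∧ (fromWitnessFalse x≢y , from (T-∨ {x = G (punchIn j x) (punchIn j y)}) (disjuncts xy))
    where
    disjuncts : ContractAdj x y → Adj G (punchIn j x) (punchIn j y) ⊎ T (via x y ∨ via y x)
    disjuncts (inj₁ a)        = inj₁ a
    disjuncts (inj₂ (inj₁ v)) = inj₂ (from (T-∨ {x = via x y}) (inj₁ (via⁺ v)))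
    disjuncts (inj₂ (inj₂ v)) = inj₂ (from (T-∨ {x = via x y}) (inj₂ (via⁺ v)))

  contract-adj⁻ : ∀ {x y} → Adj (contract G i j) x y → ContractAdj x y
  contract-adj⁻ {x} {y} xy =
    Sum.map₂ (Sum.map via⁻ via⁻ ∘ to (T-∨ {x = via x y}))
      (to (T-∨ {x = G (punchIn j x) (punchIn j y)}) (proj₂ (to (T-∧ {x = not (x ==ᶠ y)}) xy)))

  merge-adj : IsSymmetric G → ∀ {w w′} → Adj G w w′ →
              merge w ≡ merge w′ ⊎ Adj (contract G i j) (merge w) (merge w′)
  merge-adj G-sym {w} {w′} ww′ = Sum.map₂ edge (toSum (merge w ≟ merge w′))
    where
    edge : merge w ≢ merge w′ → Adj (contract G i j) (merge w) (merge w′)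
    edge differ = contract-adj⁺ differ (cases (punchIn-merge w) (punchIn-merge w′))
      where
      cases : _ → _ → ContractAdj (merge w) (merge w′)
      cases (inj₁ (refl , _)) (inj₁ (refl , _)) = contradiction refl differ
      cases (inj₁ (refl , e)) (inj₂ e′)         = inj₂ (inj₁ (e , subst (Adj G j) (sym e′) ww′))
      cases (inj₂ e)         (inj₁ (refl , e′)) =
        inj₂ (inj₂ (e′ , subst (Adj G j) (sym e) (adj-sym G-sym ww′)))
      cases (inj₂ e)         (inj₂ e′)          = inj₁ (subst₂ (Adj G) (sym e) (sym e′) ww′)

  contract-adj-lift : IsSymmetric G → ∀ {x y} → Adj (contract G i j) x y →
                      ∃₂ λ w w′ → merge w ≡ x × merge w′ ≡ y × Adj G w w′
  contract-adj-lift G-sym {x} {y} xy with contract-adj⁻ xy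
  ... | inj₁ a               = punchIn j x , punchIn j y , merge-punchIn x , merge-punchIn y , a
  ... | inj₂ (inj₁ (e , a)) = j , punchIn j y , merge-j e , merge-punchIn y , a
  ... | inj₂ (inj₂ (e , a)) = punchIn j x , j , merge-punchIn x , merge-j e , adj-sym G-sym a

  contract-model : ∀ {m} {H : Graph m} → IsSymmetric G → (M : MinorModel H G) →
                   MinorModel.branch M i ≡ MinorModel.branch M j → MinorModel H (contract G i j)
  contract-model G-sym M bi≡bj = record
    { branch      = branch′
    ; nonempty    = λ h → let v , ev = nonempty h in merge v , trans (branch′-merge v) ev
    ; connected   = λ h ex ey →
        walk-map (λ w z → merge w ≡ z) (λ e e′ → trans (sym e) e′)
          (λ {w} ew → merge w , refl , trans (branch′-merge w) ew)
          (λ { refl refl a → merge-adj G-sym a })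
          (connected h ex ey) (merge-punchIn _) (merge-punchIn _)
    ; adj-project = λ hh′ ex ey xy →
        let w , w′ , wx , w′y , ww′ = contract-adj-lift G-sym xy
        in adj-project hh′ (branch-merged wx ex) (branch-merged w′y ey) ww′
    ; adj-lift    = λ hh′ a →
        let u , v , eu , ev , uv = adj-lift hh′ a
            eu′ = trans (branch′-merge u) eu
            ev′ = trans (branch′-merge v) ev
        in merge u , merge v , eu′ , ev′ , lift-edge hh′ eu′ ev′ (merge-adj G-sym uv)
    }
    where
    open MinorModel M
    branch′ : Fin n → Maybe _
    branch′ = branch ∘ punchIn j

    branch′-merge : ∀ w → branch′ (merge w) ≡ branch w
    branch′-merge w with punchIn-merge w
    ... | inj₁ (refl , e) = trans (cong branch e) bi≡bj
    ... | inj₂ e          = cong branch e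

    branch-merged : ∀ {w x b} → merge w ≡ x → branch′ x ≡ b → branch w ≡ b
    branch-merged {w} refl e = trans (sym (branch′-merge w)) e

    lift-edge : ∀ {h h′ x y} → h ≢ h′ → branch′ x ≡ just h → branch′ y ≡ just h′ →
                x ≡ y ⊎ Adj (contract G i j) x y → Adj (contract G i j) x y
    lift-edge hh′ ex ey (inj₁ refl) = contradiction (just-injective (trans (sym ex) ey)) hh′
    lift-edge _   _  _  (inj₂ xy)  = xy

delete-symmetric : ∀ {n} (G : Graph (suc n)) → IsSymmetric G → ∀ d → IsSymmetric (delete G d)
delete-symmetric G G-sym d x y = G-sym (punchIn d x) (punchIn d y)

delete-loopless : ∀ {n} (G : Graph (suc n)) → IsLoopless G → ∀ d → IsLoopless (delete G d)
delete-loopless G G-loopless d x = G-loopless (punchIn d x)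

==ᶠ-sym : ∀ {n} (x y : Fin n) → (x ==ᶠ y) ≡ (y ==ᶠ x)
==ᶠ-sym x y = T-ext (fromWitness ∘ sym ∘ toWitness) (fromWitness ∘ sym ∘ toWitness)

contract-symmetric : ∀ {n} (G : Graph (suc n)) → IsSymmetric G → ∀ i j → IsSymmetric (contract G i j)
contract-symmetric G G-sym i j x y =
  cong₂ _∧_ (cong not (==ᶠ-sym x y))
    (cong₂ _∨_ (G-sym _ _) (∨-comm ((punchIn j x ==ᶠ i) ∧ G j (punchIn j y)) _))

contract-loopless : ∀ {n} (G : Graph (suc n)) → ∀ i j → IsLoopless (contract G i j)
contract-loopless G i j x =
  T-ext (λ t → toWitnessFalse (proj₁ (to (T-∧ {x = not (x ==ᶠ x)}) t)) refl) λ ()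

module _ {m n} {H : Graph m} {G : Graph n} (M : MinorModel H G) where
  open MinorModel M

  InnerEdge : Fin n → Fin n → Set
  InnerEdge u v = Adj G u v × ∃ λ h → branch u ≡ just h × branch v ≡ just h

  innerEdge? : Dec (∃₂ InnerEdge)
  innerEdge? = any? λ u → any? λ v → T? (G u v) ×-dec sameJust? (branch u) (branch v)

  unused? : Dec (∃ λ v → branch v ≡ nothing)
  unused? = any? λ v → ≡-decᴹ _≟_ (branch v) nothing

  branch-singleton : (∀ u v → ¬ InnerEdge u v) →
                     ∀ {u w h} → branch u ≡ just h → branch w ≡ just h → u ≡ w
  branch-singleton no-inner eu ew with connected _ eu ew
  ... | here _         = refl
  ... | step pu uv vw = contradiction (uv , _ , pu , walk-head vw) (no-inner _ _)

  model⇒≅ : IsLoopless H → IsLoopless G → (∀ v → ∃ λ h → branch v ≡ just h) →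
            (∀ {u w h} → branch u ≡ just h → branch w ≡ just h → u ≡ w) → H ≅ G
  model⇒≅ H-loopless G-loopless mapped single = record
    { to      = to′
    ; from    = from′
    ; from∘to = λ h → just-injective (trans (sym (proj₂ (mapped (to′ h)))) (proj₂ (nonempty h)))
    ; to∘from = λ v → single (proj₂ (nonempty (from′ v))) (proj₂ (mapped v))
    ; pres    = pres
    }
    where
    to′ : Fin m → Fin n
    to′ h = proj₁ (nonempty h)
    from′ : Fin n → Fin m
    from′ v = proj₁ (mapped v)

    pres : ∀ h h′ → H h h′ ≡ G (to′ h) (to′ h′)
    pres h h′ with h ≟ h′
    ... | yes refl = trans (H-loopless h) (sym (G-loopless (to′ h)))
    ... | no hh′   = T-ext lift (adj-project hh′ (proj₂ (nonempty h)) (proj₂ (nonempty h′)))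
      where
      lift : Adj H h h′ → Adj G (to′ h) (to′ h′)
      lift a = let u , v , eu , ev , uv = adj-lift hh′ a
               in subst₂ (Adj G) (single eu (proj₂ (nonempty h))) (single ev (proj₂ (nonempty h′))) uv

model⇒induced-minor : ∀ {m} {H : Graph m} → IsLoopless H → ∀ {n} {G : Graph n} →
                      IsSymmetric G → IsLoopless G → MinorModel H G → H ≼ G
model⇒induced-minor H-loopless {zero} G-sym G-loopless M =
  iso (model⇒≅ M H-loopless G-loopless (λ ()) (λ { {()} }))
model⇒induced-minor H-loopless {suc n} {G} G-sym G-loopless M with unused? M | innerEdge? M
... | yes (d , unused) | _ =
  del d (model⇒induced-minor H-loopless (delete-symmetric G G-sym d) (delete-loopless G G-loopless d)
          (delete-model M d unused))
... | no _ | yes (u , v , uv , _ , eu , ev) =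
  con u v u≢v uv (model⇒induced-minor H-loopless (contract-symmetric G G-sym u v) (contract-loopless G u v)
                   (Contraction.contract-model G u v u≢v G-sym M (trans eu (sym ev))))
  where
  u≢v : u ≢ v
  u≢v = adj⇒≢ G-loopless uv
... | no all-mapped | no no-inner =
  iso (model⇒≅ M H-loopless G-loopless (λ v → just-or-nothing _ (λ e → all-mapped (v , e)))
        (branch-singleton M λ u v inner → no-inner (u , v , inner)))

-- Counting marks

𝟙 : ∀ {A : Set} → Dec A → ℕ
𝟙 (yes _) = 1
𝟙 (no _)  = 0

count : ∀ {ℓ} {P : Pred (Fin ℓ) _} → Decidable P → ℕ
count P? = sum (𝟙 ∘ P?)

count-none : ∀ {ℓ} {P : Pred (Fin ℓ) _} (P? : Decidable P) → (∀ k → ¬ P k) → count P? ≡ 0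
count-none {zero}  P? none = refl
count-none {suc ℓ} P? none with P? zero
... | yes p = contradiction p (none zero)
... | no _  = count-none (P? ∘ suc) (none ∘ suc)

count-all : ∀ {ℓ} {P : Pred (Fin ℓ) _} (P? : Decidable P) → (∀ k → P k) → count P? ≡ ℓ
count-all {zero}  P? all = refl
count-all {suc ℓ} P? all with P? zero
... | yes _ = cong suc (count-all (P? ∘ suc) (all ∘ suc))
... | no ¬p = contradiction (all zero) ¬p

count≢0 : ∀ {ℓ} {P : Pred (Fin ℓ) _} (P? : Decidable P) → count P? ≢ 0 → ∃ P
count≢0 {zero}  P? c≢0 = contradiction refl c≢0
count≢0 {suc ℓ} P? c≢0 with P? zero
... | yes p = zero , p
... | no _  = Product.map suc id (count≢0 (P? ∘ suc) c≢0)

count≤1 : ∀ {ℓ} {P : Pred (Fin ℓ) _} (P? : Decidable P) →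
          (∀ {k k′} → P k → P k′ → k ≡ k′) → count P? ≤ 1
count≤1 {zero}  P? unique = z≤n
count≤1 {suc ℓ} P? unique with P? zero
... | yes p = ≤-reflexive (cong suc (count-none (P? ∘ suc) λ k q → 0≢1+n (unique p q)))
... | no _  = count≤1 (P? ∘ suc) λ p q → suc-injective (unique p q)

count-⊎ : ∀ {ℓ} {P Q R : Pred (Fin ℓ) _} (P? : Decidable P) (Q? : Decidable Q) (R? : Decidable R) →
          (∀ k → P k ⇔ (Q k ⊎ R k)) → (∀ k → Q k → ¬ R k) → count P? ≡ count Q? + count R?
count-⊎ P? Q? R? P⇔Q⊎R disjoint =
  trans (sum-cong-≗ pointwise) (∑-distrib-+ (𝟙 ∘ Q?) (𝟙 ∘ R?))
  where
  pointwise : ∀ k → 𝟙 (P? k) ≡ 𝟙 (Q? k) + 𝟙 (R? k)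
  pointwise k with P? k | Q? k | R? k
  ... | _     | yes q | yes r = contradiction r (disjoint k q)
  ... | yes _ | yes _ | no _  = refl
  ... | yes _ | no _  | yes _ = refl
  ... | yes p | no ¬q | no ¬r = ⊥-elim (Sum.[ ¬q , ¬r ] (to (P⇔Q⊎R k) p))
  ... | no _  | no _  | no _  = refl
  ... | no ¬p | yes q | no _  = contradiction (from (P⇔Q⊎R k) (inj₁ q)) ¬p
  ... | no ¬p | no _  | yes r = contradiction (from (P⇔Q⊎R k) (inj₂ r)) ¬p

UnitSteps : (ℕ → ℕ) → Set
UnitSteps N = ∀ c → N (suc c) ≡ N c ⊎ N (suc c) ≡ suc (N c)

module _ {N : ℕ → ℕ} (steps : UnitSteps N) where

  unitSteps-≤ : ∀ c → N c ≤ N (suc c)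
  unitSteps-≤ c = Sum.[ ≤-reflexive ∘ sym , (λ e → ≤-trans (n≤1+n _) (≤-reflexive (sym e))) ]′ (steps c)

  unitSteps-≤suc : ∀ c → N (suc c) ≤ suc (N c)
  unitSteps-≤suc c = Sum.[ (λ e → ≤-trans (≤-reflexive e) (n≤1+n _)) , ≤-reflexive ]′ (steps c)

  unitSteps-mono : ∀ {a b} → a ≤ b → N a ≤ N b
  unitSteps-mono {b = zero}  z≤n = ≤-refl
  unitSteps-mono {b = suc b} a≤1+b with m≤n⇒m<n∨m≡n a≤1+b
  ... | inj₁ a<1+b = ≤-trans (unitSteps-mono (≤-pred a<1+b)) (unitSteps-≤ b)
  ... | inj₂ refl  = ≤-refl

  unitSteps-crossing : ∀ m {t} → N 0 ≤ t → t < N m → ∃ λ c → c < m × N c ≡ t × N (suc c) ≡ suc t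
  unitSteps-crossing zero    N0≤t t<N0 = contradiction (≤-<-trans N0≤t t<N0) (<-irrefl refl)
  unitSteps-crossing (suc m) {t} N0≤t t<N[1+m] with t <? N m
  ... | yes t<Nm = let c , c<m , rest = unitSteps-crossing m N0≤t t<Nm in c , m<n⇒m<1+n c<m , rest
  ... | no t≮Nm  = m , ≤-refl , Nm≡t , N[1+m]≡1+t (steps m)
    where
    Nm≡t : N m ≡ t
    Nm≡t = ≤-antisym (≮⇒≥ t≮Nm) (≤-pred (≤-trans t<N[1+m] (unitSteps-≤suc m)))
    N[1+m]≡1+t : N (suc m) ≡ N m ⊎ N (suc m) ≡ suc (N m) → N (suc m) ≡ suc t
    N[1+m]≡1+t (inj₁ e) = contradiction (subst (t <_) (trans e Nm≡t) t<N[1+m]) (<-irrefl refl)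
    N[1+m]≡1+t (inj₂ e) = trans e (cong suc Nm≡t)

unitSteps-pred : ∀ {N} → UnitSteps N → UnitSteps (pred ∘ N)
unitSteps-pred {N} steps c with N (suc c) | N c | steps c
... | _     | _     | inj₁ refl = inj₁ refl
... | suc _ | zero  | inj₂ refl = inj₁ refl
... | suc _ | suc _ | inj₂ refl = inj₂ refl

module Marks {ℓ} (F : Fin ℓ → ℕ) (F-injective : Injective _≡_ _≡_ F) where

  below : ℕ → ℕ
  below c = count (λ k → F k <? c)

  below-zero : below 0 ≡ 0
  below-zero = count-none (λ k → F k <? 0) λ k ()

  below-all : ∀ {c} → (∀ k → F k < c) → below c ≡ ℓ
  below-all {c} = count-all (λ k → F k <? c)

  below-suc : ∀ c → below (suc c) ≡ below c + count (λ k → F k ℕ.≟ c)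
  below-suc c = count-⊎ (λ k → F k <? suc c) (λ k → F k <? c) (λ k → F k ℕ.≟ c)
    (λ k → mk⇔ m<1+n⇒m<n∨m≡n Sum.[ m<n⇒m<1+n , (λ { refl → n<1+n _ }) ])
    (λ k → <⇒≢)

  private
    marks-at≤1 : ∀ c → count (λ k → F k ℕ.≟ c) ≤ 1
    marks-at≤1 c = count≤1 (λ k → F k ℕ.≟ c) λ e e′ → F-injective (trans e (sym e′))

  below-unitSteps : UnitSteps below
  below-unitSteps c with count (λ k → F k ℕ.≟ c) | marks-at≤1 c | below-suc c
  ... | 0 | _        | e = inj₁ (trans e (+-identityʳ _))
  ... | 1 | _        | e = inj₂ (trans e (+-comm _ 1))
  ... | suc (suc _) | s≤s () | _

  below-jump : ∀ {c} → below (suc c) ≡ suc (below c) → ∃ λ k → F k ≡ c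
  below-jump {c} jump = count≢0 (λ k → F k ℕ.≟ c) λ no-mark → 1+n≢n (begin
    suc (below c)                       ≡⟨ jump ⟨
    below (suc c)                       ≡⟨ below-suc c ⟩
    below c + count (λ k → F k ℕ.≟ c)   ≡⟨ cong (below c +_) no-mark ⟩
    below c + 0                         ≡⟨ +-identityʳ _ ⟩
    below c                             ∎)
    where open ≡-Reasoning

-- Arcs of a cycle

T-cycSucc : ∀ {m} {x y : Fin m} → T (cycSucc m x y) ⇔ (toℕ y ≡ suc (toℕ x) ⊎ (suc (toℕ x) ≡ m × toℕ y ≡ 0))
T-cycSucc {m} {x} {y} = mk⇔
  (Sum.map (≡ᵇ⇒≡ _ _)
           (λ t → let e , e′ = to (T-∧ {x = suc (toℕ x) ≡ᵇ m}) t in ≡ᵇ⇒≡ _ _ e , ≡ᵇ⇒≡ _ _ e′)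
     ∘ to (T-∨ {x = toℕ y ≡ᵇ suc (toℕ x)}))
  (from (T-∨ {x = toℕ y ≡ᵇ suc (toℕ x)})
     ∘ Sum.map (≡⇒≡ᵇ _ _) (λ { (e , e′) → from T-∧ (≡⇒≡ᵇ _ _ e , ≡⇒≡ᵇ _ _ e′) }))

module Arcs {ℓ L} (ℓ≥1 : 1 ≤ ℓ) (f : Fin ℓ → Fin L) (f-injective : Injective _≡_ _≡_ f) where

  open Marks (toℕ ∘ f) (f-injective ∘ toℕ-injective)

  private
    instance
      ℓ-nonZero : ℕ.NonZero ℓ
      ℓ-nonZero = >-nonZero ℓ≥1
      L-nonZero : ℕ.NonZero L
      L-nonZero = >-nonZero (≤-<-trans z≤n (toℕ<n (f (fromℕ< ℓ≥1))))

  -- arcℕ c + 1 is the number of marks at positions ≤ c, except that the positions before the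
  -- first mark also land in arc 0, through pred 0 ≡ 0.
  arcℕ : ℕ → ℕ
  arcℕ c = pred (below (suc c))

  arcℕ-unitSteps : UnitSteps arcℕ
  arcℕ-unitSteps c = unitSteps-pred below-unitSteps (suc c)

  arcℕ-zero : arcℕ 0 ≡ 0
  arcℕ-zero = Sum.[ (λ e → cong pred (trans e below-zero))
                  , (λ e → cong pred (trans e (cong suc below-zero))) ]′ (below-unitSteps 0)

  arcℕ-last : ∀ {c} → suc c ≡ L → arcℕ c ≡ pred ℓ
  arcℕ-last refl = cong pred (below-all (toℕ<n ∘ f))

  arcℕ<ℓ : ∀ {c} → c < L → arcℕ c < ℓ
  arcℕ<ℓ c<L = m≤pred[n]⇒suc[m]≤n
    (pred-mono-≤ (≤-trans (unitSteps-mono below-unitSteps c<L) (≤-reflexive (below-all (toℕ<n ∘ f)))))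

  arc : Fin L → Fin ℓ
  arc c = fromℕ< (arcℕ<ℓ (toℕ<n c))

  toℕ-arc : ∀ c → toℕ (arc c) ≡ arcℕ (toℕ c)
  toℕ-arc c = toℕ-fromℕ< _

  arc-mono : ∀ {c d} → toℕ c ≤ toℕ d → toℕ (arc c) ≤ toℕ (arc d)
  arc-mono {c} {d} c≤d rewrite toℕ-arc c | toℕ-arc d = unitSteps-mono arcℕ-unitSteps c≤d

  arc-convex : ∀ {c c′ d} → arc c ≡ arc c′ → toℕ c ≤ toℕ d → toℕ d ≤ toℕ c′ → arc d ≡ arc c
  arc-convex same c≤d d≤c′ =
    toℕ-injective (≤-antisym (≤-trans (arc-mono d≤c′) (≤-reflexive (cong toℕ (sym same)))) (arc-mono c≤d))

  arc-step : ∀ {c c′} → toℕ c′ ≡ suc (toℕ c) →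
             toℕ (arc c′) ≡ toℕ (arc c) ⊎ toℕ (arc c′) ≡ suc (toℕ (arc c))
  arc-step {c} {c′} c′≡1+c rewrite toℕ-arc c | toℕ-arc c′ | c′≡1+c = arcℕ-unitSteps (toℕ c)

  arc-first : ∀ {c} → toℕ c ≡ 0 → toℕ (arc c) ≡ 0
  arc-first {c} c≡0 rewrite toℕ-arc c | c≡0 = arcℕ-zero

  arc-last : ∀ {c} → suc (toℕ c) ≡ L → suc (toℕ (arc c)) ≡ ℓ
  arc-last {c} 1+c≡L rewrite toℕ-arc c = trans (cong suc (arcℕ-last 1+c≡L)) (suc-pred ℓ)

  arc-marked : ∀ r → ∃ λ k → arc (f k) ≡ r
  arc-marked r =
    let c , _ , below-c , jump =
          unitSteps-crossing below-unitSteps L (≤-trans (≤-reflexive below-zero) z≤n) r<ℓ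
        k , fk≡c = below-jump (trans jump (cong suc (sym below-c)))
    in k , toℕ-injective (trans (toℕ-arc (f k)) (trans (cong arcℕ fk≡c) (cong pred jump)))
    where
    r<ℓ : toℕ r < below L
    r<ℓ = subst (toℕ r <_) (sym (below-all (toℕ<n ∘ f))) (toℕ<n r)

  arc-cycSucc : ∀ {c c′} → T (cycSucc L c c′) → arc c ≡ arc c′ ⊎ T (cycSucc ℓ (arc c) (arc c′))
  arc-cycSucc t with to T-cycSucc t
  ... | inj₁ c′≡1+c         = Sum.map (sym ∘ toℕ-injective) (from T-cycSucc ∘ inj₁) (arc-step c′≡1+c)
  ... | inj₂ (1+c≡L , c′≡0) = inj₂ (from T-cycSucc (inj₂ (arc-last 1+c≡L , arc-first c′≡0)))

  arc-boundary : ∀ {r r′} → T (cycSucc ℓ r r′) → ∃₂ λ c c′ → arc c ≡ r × arc c′ ≡ r′ × T (cycSucc L c c′)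
  arc-boundary {r} {r′} t with to T-cycSucc t
  ... | inj₁ r′≡1+r =
    let c , c<pred[L] , arc-c , arc-1+c =
          unitSteps-crossing arcℕ-unitSteps (pred L) (≤-trans (≤-reflexive arcℕ-zero) z≤n) r<last
        c<L = <-≤-trans c<pred[L] pred[n]≤n
        1+c<L = m≤pred[n]⇒suc[m]≤n {n = L} c<pred[L]
    in fromℕ< c<L , fromℕ< 1+c<L ,
       arc-fromℕ< c<L arc-c , arc-fromℕ< 1+c<L (trans arc-1+c (sym r′≡1+r)) ,
       from T-cycSucc (inj₁ (trans (toℕ-fromℕ< 1+c<L) (cong suc (sym (toℕ-fromℕ< c<L)))))
    where
    r<last : toℕ r < arcℕ (pred L)
    r<last = subst (toℕ r <_) (sym (arcℕ-last (suc-pred L))) (<⇒≤pred (subst (_< ℓ) r′≡1+r (toℕ<n r′)))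
    arc-fromℕ< : ∀ {c r} (c<L : c < L) → arcℕ c ≡ toℕ r → arc (fromℕ< c<L) ≡ r
    arc-fromℕ< c<L e = toℕ-injective (trans (toℕ-arc _) (trans (cong arcℕ (toℕ-fromℕ< c<L)) e))
  ... | inj₂ (1+r≡ℓ , r′≡0) =
    fromℕ< last<L , fromℕ< first<L ,
    toℕ-injective (cong pred (trans (arc-last 1+last≡L) (sym 1+r≡ℓ))) ,
    toℕ-injective (trans (arc-first (toℕ-fromℕ< first<L)) (sym r′≡0)) ,
    from T-cycSucc (inj₂ (1+last≡L , toℕ-fromℕ< first<L))
    where
    last<L : pred L < L
    last<L = m≤pred[n]⇒suc[m]≤n {n = L} ≤-refl
    first<L : 0 < L
    first<L = ≤-<-trans z≤n last<L
    1+last≡L : suc (toℕ (fromℕ< last<L)) ≡ L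
    1+last≡L = trans (cong suc (toℕ-fromℕ< last<L)) (suc-pred L)

-- The wheel model

wheel-loopless : ∀ {ℓ} → 2 ≤ ℓ → IsLoopless (wheel ℓ)
wheel-loopless ℓ≥2 zero    = refl
wheel-loopless {ℓ} ℓ≥2 (suc r) = T-ext (Sum.[ no-loop , no-loop ] ∘ to T-∨) λ ()
  where
  no-loop : ¬ T (cycSucc ℓ r r)
  no-loop t with to T-cycSucc t
  ... | inj₁ r≡1+r         = 1+n≢n (sym r≡1+r)
  ... | inj₂ (1+r≡ℓ , r≡0) =
    contradiction (subst (2 ≤_) (trans (sym 1+r≡ℓ) (cong suc r≡0)) ℓ≥2) λ { (s≤s ()) }

module _ {n} {G : Graph n} (C : InducedCycle G) where

  cycle-adj : ∀ {c c′} → T (cycSucc (len C) c c′) → Adj G (vtx C c) (vtx C c′)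
  cycle-adj {c} {c′} t = subst T (sym (induced C c c′)) (from T-∨ (inj₁ t))

  cycle-adj⁻ : ∀ {c c′} → Adj G (vtx C c) (vtx C c′) → T (cycSucc (len C) c c′) ⊎ T (cycSucc (len C) c′ c)
  cycle-adj⁻ {c} {c′} a = to T-∨ (subst T (induced C c c′) a)

  cycle-walk-≤ : ∀ {P c c′} → toℕ c ≤ toℕ c′ → (∀ d → toℕ c ≤ toℕ d → toℕ d ≤ toℕ c′ → P (vtx C d)) →
                 Walk G P (vtx C c) (vtx C c′)
  cycle-walk-≤ {P} {c} {c′} c≤c′ inside = go (toℕ c′ ∸ toℕ c) ≤-refl (m+[n∸m]≡n c≤c′)
    where
    go : ∀ gap {d} → toℕ c ≤ toℕ d → toℕ d + gap ≡ toℕ c′ → Walk G P (vtx C d) (vtx C c′)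
    go zero {d} c≤d d+0≡c′ with toℕ-injective (trans (sym (+-identityʳ (toℕ d))) d+0≡c′)
    ... | refl = here (inside d c≤d ≤-refl)
    go (suc gap) {d} c≤d d+1+gap≡c′ =
      step (inside d c≤d (<⇒≤ d<c′)) (cycle-adj (from T-cycSucc (inj₁ (toℕ-fromℕ< 1+d<L))))
           (go gap (≤-trans c≤d (≤-trans (n≤1+n _) (≤-reflexive (sym (toℕ-fromℕ< 1+d<L)))))
                   (trans (cong (_+ gap) (toℕ-fromℕ< 1+d<L)) 1+d+gap≡c′))
      where
      1+d+gap≡c′ : suc (toℕ d) + gap ≡ toℕ c′
      1+d+gap≡c′ = trans (sym (+-suc (toℕ d) gap)) d+1+gap≡c′
      d<c′ : toℕ d < toℕ c′
      d<c′ = subst (toℕ d <_) 1+d+gap≡c′ (s≤s (m≤m+n (toℕ d) gap))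
      1+d<L : suc (toℕ d) < len C
      1+d<L = ≤-<-trans d<c′ (toℕ<n c′)

flip-edge : ∀ {n} {G : Graph n} {P Q : Fin n → Set} → IsSymmetric G →
            (∃₂ λ u v → P u × Q v × Adj G u v) → ∃₂ λ v u → Q v × P u × Adj G v u
flip-edge G-sym (u , v , pu , qv , uv) = v , u , qv , pu , adj-sym G-sym uv

module WheelModel {ℓ} (ℓ≥1 : 1 ≤ ℓ) {n} {G : Graph n} (G-sym : IsSymmetric G)
  (C : InducedCycle G) {S : Fin n → Bool} (S-component : IsComponent G C S)
  (f : Fin ℓ → Fin (len C)) (f-injective : Injective _≡_ _≡_ f)
  (f-neighbours : ∀ k → NbrInC C S (f k)) where

  open Arcs ℓ≥1 f f-injective
  open IsComponent S-component using (avoids; conn)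

  branch : Fin n → Maybe (Fin (suc ℓ))
  branch w with S w | any? (λ c → vtx C c ≟ w)
  ... | true  | _           = just zero
  ... | false | yes (c , _) = just (suc (arc c))
  ... | false | no _        = nothing

  branch-hub⁺ : ∀ {w} → T (S w) → branch w ≡ just zero
  branch-hub⁺ {w} w∈S with S w | any? (λ c → vtx C c ≟ w)
  ... | true | _ = refl

  branch-hub⁻ : ∀ {w} → branch w ≡ just zero → T (S w)
  branch-hub⁻ {w} e with S w | any? (λ c → vtx C c ≟ w)
  ... | true  | _ = _
  branch-hub⁻ () | false | yes _
  branch-hub⁻ () | false | no _

  branch-rim⁺ : ∀ {c r} → arc c ≡ r → branch (vtx C c) ≡ just (suc r)
  branch-rim⁺ {c} refl with S (vtx C c) in e | any? (λ c′ → vtx C c′ ≟ vtx C c)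
  ... | true  | _            = contradiction (c , refl) (avoids (vtx C c) (subst T (sym e) _))
  ... | false | yes (c′ , e′) = cong (just ∘ suc ∘ arc) (inj C e′)
  ... | false | no none      = contradiction (c , refl) none

  branch-rim⁻ : ∀ {w r} → branch w ≡ just (suc r) → ∃ λ c → vtx C c ≡ w × arc c ≡ r
  branch-rim⁻ {w} e with S w | any? (λ c → vtx C c ≟ w)
  branch-rim⁻ () | true | _
  branch-rim⁻ {w} refl | false | yes (c , vc≡w) = c , vc≡w , refl
  branch-rim⁻ () | false | no _

  rim-walk-≤ : ∀ {r c c′} → arc c ≡ r → arc c′ ≡ r → toℕ c ≤ toℕ c′ →
              Walk G (λ w → branch w ≡ just (suc r)) (vtx C c) (vtx C c′)
  rim-walk-≤ arc-c arc-c′ c≤c′ = cycle-walk-≤ C c≤c′ λ d lo hi →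
    branch-rim⁺ (trans (arc-convex (trans arc-c (sym arc-c′)) lo hi) arc-c)

  rim-walk : ∀ {r c c′} → arc c ≡ r → arc c′ ≡ r →
             Walk G (λ w → branch w ≡ just (suc r)) (vtx C c) (vtx C c′)
  rim-walk {c = c} {c′} arc-c arc-c′ with ≤-total (toℕ c) (toℕ c′)
  ... | inj₁ c≤c′ = rim-walk-≤ arc-c arc-c′ c≤c′
  ... | inj₂ c′≤c = walk-reverse G-sym (rim-walk-≤ arc-c′ arc-c c′≤c)

  branch-connected : ∀ h {u v} → branch u ≡ just h → branch v ≡ just h →
                     Walk G (λ w → branch w ≡ just h) u v
  branch-connected zero eu ev = walk-weaken branch-hub⁺ (conn _ _ (branch-hub⁻ eu) (branch-hub⁻ ev))
  branch-connected (suc r) eu ev with branch-rim⁻ eu | branch-rim⁻ ev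
  ... | c , refl , arc-c | c′ , refl , arc-c′ = rim-walk arc-c arc-c′

  hub-rim : ∀ r → ∃₂ λ u v → branch u ≡ just zero × branch v ≡ just (suc r) × Adj G u v
  hub-rim r = let k , arc-fk = arc-marked r
                  s , s∈S , s~fk = f-neighbours k
              in s , vtx C (f k) , branch-hub⁺ s∈S , branch-rim⁺ arc-fk , s~fk

  rim-rim : ∀ {r r′} → T (cycSucc ℓ r r′) →
            ∃₂ λ u v → branch u ≡ just (suc r) × branch v ≡ just (suc r′) × Adj G u v
  rim-rim t = let c , c′ , arc-c , arc-c′ , cc′ = arc-boundary t
              in vtx C c , vtx C c′ , branch-rim⁺ arc-c , branch-rim⁺ arc-c′ , cycle-adj C cc′

  rim-adj : ∀ {c c′} → arc c ≢ arc c′ → Adj G (vtx C c) (vtx C c′) →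
            Adj (wheel ℓ) (suc (arc c)) (suc (arc c′))
  rim-adj {c} {c′} differ cc′ =
    from T-∨ (Sum.map (along differ) (along (differ ∘ sym)) (cycle-adj⁻ C cc′))
    where
    along : ∀ {d d′} → arc d ≢ arc d′ → T (cycSucc (len C) d d′) → T (cycSucc ℓ (arc d) (arc d′))
    along differ′ t = Sum.[ (λ same → contradiction same differ′) , id ]′ (arc-cycSucc t)

  wheel-model : MinorModel (wheel ℓ) G
  wheel-model .MinorModel.branch = branch
  wheel-model .MinorModel.nonempty zero =
    let s , s∈S = IsComponent.nonempty S-component in s , branch-hub⁺ s∈S
  wheel-model .MinorModel.nonempty (suc r) =
    let k , arc-fk = arc-marked r in vtx C (f k) , branch-rim⁺ arc-fk
  wheel-model .MinorModel.connected = branch-connected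
  wheel-model .MinorModel.adj-project {zero}  {zero}   hh′ _ _ _ = contradiction refl hh′
  wheel-model .MinorModel.adj-project {zero}  {suc _}  _ _ _ _ = _
  wheel-model .MinorModel.adj-project {suc _} {zero}   _ _ _ _ = _
  wheel-model .MinorModel.adj-project {suc r} {suc r′} rr′ eu ev uv with branch-rim⁻ eu | branch-rim⁻ ev
  ... | c , refl , refl | c′ , refl , refl = rim-adj (rr′ ∘ cong suc) uv
  wheel-model .MinorModel.adj-lift {zero}  {suc r}  _ _ = hub-rim r
  wheel-model .MinorModel.adj-lift {suc r} {zero}   _ _ = flip-edge G-sym (hub-rim r)
  wheel-model .MinorModel.adj-lift {suc r} {suc r′} _ t =
    Sum.[ rim-rim , flip-edge G-sym ∘ rim-rim ]′ (to (T-∨ {x = cycSucc ℓ r r′}) t)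

mainTheorem3 : (ℓ : ℕ) → 3 ≤ ℓ → ∀ {n} (G : Graph n) → IsSimple G →
    (C : InducedCycle G) → (S : Fin n → Bool) → IsComponent G C S →
    (∃ λ (f : Fin ℓ → Fin (len C)) → Injective _≡_ _≡_ f × (∀ k → NbrInC C S (f k))) →
    wheel ℓ ≼ G
mainTheorem3 ℓ ℓ≥3 G (G-sym , G-loopless) C S S-component (f , f-injective , f-neighbours) =
  model⇒induced-minor (wheel-loopless ℓ≥2) G-sym G-loopless
    (WheelModel.wheel-model ℓ≥1 G-sym C S-component f f-injective f-neighbours)
  where
  ℓ≥2 : 2 ≤ ℓ
  ℓ≥2 = ≤-trans (n≤1+n 2) ℓ≥3
  ℓ≥1 : 1 ≤ ℓ
  ℓ≥1 = ≤-trans (n≤1+n 1) ℓ≥2
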